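{- If $n\ge 4$ and $n\equiv 0\pmod 4$, then $\zeta(G_n)=4$.
   Context: $G_n=C_n\square P_2$ is the prism graph with vertex set $\{(t,i),(b,i): i\in\mathbb{Z}_n\}$, with $(t,i)$ adjacent to $(t,i\pm1)$ and $(b,i)$, and $(b,i)$ adjacent to $(b,i\pm1)$ and $(t,i)$. $\zeta(G)$ denotes the number of dominating sets of $G$ of minimum size $\gamma(G)$, counting distinct vertex subsets of the labeled graph separately. -}

module Defs where

open import Data.Nat using (ℕ; _≤_; _+_)
open import Data.Fin using (Fin)
open import Data.Bool using (Bool; true; false)
open import Data.Vec using (Vec; lookup; count)
open import Data.Product using (_×_; _,_; ∃-syntax)
open import Data.Sum using (_⊎_)
open import Data.Bool using (T)
open import Data.Nat.Properties using ()
open import Relation.Nullary using (Dec)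
open import Data.Bool.Properties using (T?)

-- Prism graph G_n = C_n □ P_2, n ≥ 3.
-- A vertex is (s , i) with s : Side (top t / bottom b) and i : Fin n (ℤ_n).
data Side : Set where
  t b : Side

other : Side → Side
other t = b
other b = t

Vertex : ℕ → Set
Vertex n = Side × Fin n

open import Data.Fin using (toℕ)
open import Data.Nat.DivMod using (_%_)
open import Data.Nat using (suc; NonZero)
open import Relation.Binary.PropositionalEquality using (_≡_)

cycAdj : (n : ℕ) → .{{NonZero n}} → Fin n → Fin n → Set
cycAdj n i j = (toℕ j ≡ (suc (toℕ i)) % n) ⊎ (toℕ i ≡ (suc (toℕ j)) % n)

Adj : (n : ℕ) → .{{NonZero n}} → Vertex n → Vertex n → Set
Adj n (s , i) (s' , j) = (s ≡ s' × cycAdj n i j) ⊎ (s' ≡ other s × i ≡ j)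

-- A vertex subset of G_n: characteristic vectors of its top and bottom vertices.
-- Distinct subsets of the labeled graph correspond to distinct pairs of vectors.
VSet : ℕ → Set
VSet n = Vec Bool n × Vec Bool n

_∈ₛ_ : ∀ {n} → Vertex n → VSet n → Set
(t , i) ∈ₛ (T₀ , B₀) = T (lookup T₀ i)
(b , i) ∈ₛ (T₀ , B₀) = T (lookup B₀ i)

size : ∀ {n} → VSet n → ℕ
size (T₀ , B₀) = count T? T₀ + count T? B₀

Dominating : (n : ℕ) → .{{NonZero n}} → VSet n → Set
Dominating n S = (v : Vertex n) → v ∈ₛ S ⊎ (∃[ u ] (u ∈ₛ S × Adj n v u))

MinDominating : (n : ℕ) → .{{NonZero n}} → VSet n → Set
MinDominating n S = Dominating n S × ((S' : VSet n) → Dominating n S' → size S ≤ size S')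

-- Proof-irrelevant wrapper, so that Σ (VSet n) (IsMinDom n) counts vertex
-- subsets rather than (subset, proof) pairs.
record IsMinDom (n : ℕ) .{{_ : NonZero n}} (S : VSet n) : Set where
  constructor isMinDom
  field
    .proof : MinDominating n S

{-# OPTIONS --safe #-}
module Submission where

-- G_n is 3-regular, so every vertex has a closed neighbourhood of four vertices and double counting
-- gives Σ_v |N[v] ∩ S| = 4|S| for every vertex set S. For a dominating set every term is ≥ 1, so
-- |S| ≥ n/2, with equality exactly for perfect sets, in which every term is 1. Unrolling the cycle, a
-- perfect set becomes a perfect code of the ladder ℕ □ P₂: each column holds at most one vertex, two
-- adjacent columns hold exactly one, and two consecutive columns determine their neighbouring columns.
-- So the only candidates are the four sets with top vertices in the columns ≡ r and bottom vertices in
-- the columns ≡ r + 2 (mod 4), and these are perfect because 4 ∣ n.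

open import Defs
open import Data.Bool using (Bool; true; false; T)
open import Data.Bool.Properties using (T?) renaming (_≟_ to _≟ᵇ_)
open import Data.Fin using (Fin; zero; suc; toℕ; fromℕ<)
open import Data.Fin.Permutation using (Permutation; permutation; flip)
open import Data.Fin.Properties using (toℕ-injective; toℕ-fromℕ<; toℕ<n; all?; any?)
  renaming (_≟_ to _≟ᶠ_)
open import Data.List using (List; []; _∷_; _++_)
open import Data.List.Relation.Unary.Any using (Any; here; there)
open import Data.Nat using (ℕ; zero; suc; _+_; _*_; _∸_; _/_; _%_; pred; _≤_; z≤n; s≤s; NonZero)
open import Data.Nat.DivMod using (_mod_; m≡m%n+[m/n]*n; m%n%n≡m%n; %-distribˡ-+; %-remove-+ˡ; m<n⇒m%n≡m)
open import Data.Nat.Divisibility using (_∣_; divides; ∣-refl; m%n≡0⇒n∣m)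
open import Data.Nat.Properties
open import Algebra.Properties.CommutativeMonoid.Sum +-0-commutativeMonoid
  using (sum; sum-syntax; ∑-distrib-+; ∑-permute)
open import Data.Nat.Tactic.RingSolver using (solve-∀)
open import Data.Product using (Σ; _×_; _,_; proj₁; proj₂; ∃-syntax)
open import Data.Product.Properties using (Σ-≡,≡→≡) renaming (≡-dec to ×-≡-dec)
open import Data.Sum using (_⊎_; inj₁; inj₂)
open import Data.Vec using (Vec; []; _∷_; lookup; tabulate; count)
open import Data.Vec.Properties using (lookup∘tabulate; tabulate∘lookup; tabulate-cong)
  renaming (≡-dec to Vec-≡-dec)
open import Function using (_∘_)
open import Function.Bundles using (_↔_; mk↔ₛ′)
open import Function.Definitions using (Injective)
open import Relation.Binary.Definitions using (DecidableEquality)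
open import Relation.Binary.PropositionalEquality
  using (_≡_; refl; sym; trans; cong; cong₂; subst; _≗_; module ≡-Reasoning)
open import Relation.Nullary using (Irrelevant)
open import Relation.Nullary.Decidable using (from-yes; recompute; _→-dec_)

⟦_⟧ : Bool → ℕ
⟦ true  ⟧ = 1
⟦ false ⟧ = 0

⟦⟧-injective : ∀ {p q} → ⟦ p ⟧ ≡ ⟦ q ⟧ → p ≡ q
⟦⟧-injective {false} {false} _ = refl
⟦⟧-injective {true}  {true}  _ = refl
⟦⟧-injective {false} {true}  ()
⟦⟧-injective {true}  {false} ()

ones : List Bool → ℕ
ones []       = 0
ones (a ∷ as) = ⟦ a ⟧ + ones as

ones-positive⇒Any : ∀ as → 1 ≤ ones as → Any T as
ones-positive⇒Any []           ()
ones-positive⇒Any (true  ∷ as) _ = here _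
ones-positive⇒Any (false ∷ as) h = there (ones-positive⇒Any as h)

Any⇒ones-positive : ∀ {as} → Any T as → 1 ≤ ones as
Any⇒ones-positive {true  ∷ as} (here _)  = s≤s z≤n
Any⇒ones-positive {false ∷ as} (here ())
Any⇒ones-positive {a ∷ as}     (there p) = ≤-trans (Any⇒ones-positive p) (m≤n+m _ ⟦ a ⟧)

ones-cancel : ∀ as {bs c c′} → ones (as ++ c ∷ bs) ≡ ones (as ++ c′ ∷ bs) → c ≡ c′
ones-cancel []       {bs} e = ⟦⟧-injective (+-cancelʳ-≡ (ones bs) _ _ e)
ones-cancel (a ∷ as)      e = ones-cancel as (+-cancelˡ-≡ ⟦ a ⟧ _ _ e)

count-T?-as-∑ : ∀ {n} (V : Vec Bool n) → count T? V ≡ ∑[ j < n ] ⟦ lookup V j ⟧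
count-T?-as-∑ []          = refl
count-T?-as-∑ (true  ∷ V) = cong suc (count-T?-as-∑ V)
count-T?-as-∑ (false ∷ V) = count-T?-as-∑ V

∑-ones : ∀ {n} (f₁ f₂ f₃ f₄ : Fin n → Bool) →
         ∑[ j < n ] ones (f₁ j ∷ f₂ j ∷ f₃ j ∷ f₄ j ∷ []) ≡
         ∑[ j < n ] ⟦ f₁ j ⟧ + ∑[ j < n ] ⟦ f₂ j ⟧ + ∑[ j < n ] ⟦ f₃ j ⟧ + ∑[ j < n ] ⟦ f₄ j ⟧
∑-ones {zero}  f₁ f₂ f₃ f₄ = refl
∑-ones {suc n} f₁ f₂ f₃ f₄ =
  trans (cong (ones (f₁ zero ∷ f₂ zero ∷ f₃ zero ∷ f₄ zero ∷ []) +_)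
              (∑-ones (f₁ ∘ suc) (f₂ ∘ suc) (f₃ ∘ suc) (f₄ ∘ suc)))
        (regroup ⟦ f₁ zero ⟧ ⟦ f₂ zero ⟧ ⟦ f₃ zero ⟧ ⟦ f₄ zero ⟧ _ _ _ _)
  where
    regroup : ∀ x y z w X Y Z W →
              x + (y + (z + (w + 0))) + (X + Y + Z + W) ≡ (x + X) + (y + Y) + (z + Z) + (w + W)
    regroup = solve-∀

+-mono-≤-tight : ∀ {m m′ n n′} → m ≤ m′ → n ≤ n′ → m′ + n′ ≤ m + n → m ≡ m′ × n ≡ n′
+-mono-≤-tight {m} {m′} {n} {n′} m≤m′ n≤n′ m′+n′≤m+n =
  ≤-antisym m≤m′ (+-cancelʳ-≤ n′ m′ m (≤-trans m′+n′≤m+n (+-monoʳ-≤ m n≤n′))) ,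
  ≤-antisym n≤n′ (+-cancelˡ-≤ m′ n′ n (≤-trans m′+n′≤m+n (+-monoˡ-≤ n m≤m′)))

∑-mono-≤ : ∀ {n} {f g : Fin n → ℕ} → (∀ i → f i ≤ g i) → sum f ≤ sum g
∑-mono-≤ {zero}  _   = z≤n
∑-mono-≤ {suc n} f≤g = +-mono-≤ (f≤g zero) (∑-mono-≤ (f≤g ∘ suc))

∑-mono-≤-tight : ∀ {n} {f g : Fin n → ℕ} → (∀ i → f i ≤ g i) → sum g ≤ sum f → ∀ i → f i ≡ g i
∑-mono-≤-tight {zero}          _   _     ()
∑-mono-≤-tight {suc n} {f} {g} f≤g ∑g≤∑f = pointwise
  where
    head-and-tail : f zero ≡ g zero × sum (f ∘ suc) ≡ sum (g ∘ suc)
    head-and-tail = +-mono-≤-tight (f≤g zero) (∑-mono-≤ (f≤g ∘ suc)) ∑g≤∑f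
    pointwise : ∀ i → f i ≡ g i
    pointwise zero    = proj₁ head-and-tail
    pointwise (suc i) = ∑-mono-≤-tight (f≤g ∘ suc) (≤-reflexive (sym (proj₂ head-and-tail))) i

[m+n%d]%d≡[m+n]%d : ∀ m n d .{{_ : NonZero d}} → (m + n % d) % d ≡ (m + n) % d
[m+n%d]%d≡[m+n]%d m n d = begin
  (m + n % d) % d          ≡⟨ %-distribˡ-+ m (n % d) d ⟩
  (m % d + n % d % d) % d  ≡⟨ cong (λ k → (m % d + k) % d) (m%n%n≡m%n n d) ⟩
  (m % d + n % d) % d      ≡⟨ %-distribˡ-+ m n d ⟨
  (m + n) % d              ∎
  where open ≡-Reasoning

Periodic : ∀ {a} {A : Set a} → ℕ → (ℕ → A) → Set a
Periodic p f = ∀ i → f (p + i) ≡ f i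

module _ {a} {A : Set a} {f : ℕ → A} where

  periodic-* : ∀ {p} → Periodic p f → ∀ k → Periodic (k * p) f
  periodic-*     per zero    i = refl
  periodic-* {p} per (suc k) i = trans (cong f (+-assoc p (k * p) i)) (trans (per _) (periodic-* per k i))

  periodic-∣ : ∀ {p q} → p ∣ q → Periodic p f → Periodic q f
  periodic-∣ (divides k refl) per = periodic-* per k

  periodic-% : ∀ {p} .{{_ : NonZero p}} → Periodic p f → ∀ i → f (i % p) ≡ f i
  periodic-% {p} per i = begin
    f (i % p)              ≡⟨ periodic-* per (i / p) (i % p) ⟨
    f (i / p * p + i % p)  ≡⟨ cong f (+-comm (i / p * p) (i % p)) ⟩
    f (i % p + i / p * p)  ≡⟨ cong f (m≡m%n+[m/n]*n i p) ⟨
    f i                    ∎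
    where open ≡-Reasoning

-- Two rows x, y of Booleans describe a vertex set of the ladder ℕ □ P₂; ladderNbhd x y i lists the
-- memberships in the closed neighbourhood of the x-row vertex in column suc i.
ladderNbhd : (ℕ → Bool) → (ℕ → Bool) → ℕ → List Bool
ladderNbhd x y i = x i ∷ x (suc i) ∷ x (suc (suc i)) ∷ y (suc i) ∷ []

LadderPerfect : (ℕ → Bool) → (ℕ → Bool) → Set
LadderPerfect x y = ∀ i → ones (ladderNbhd x y i) ≡ 1 × ones (ladderNbhd y x i) ≡ 1

ladderPerfect-cong : ∀ {x y x′ y′} → x ≗ x′ → y ≗ y′ → LadderPerfect x y → LadderPerfect x′ y′
ladderPerfect-cong {x} {y} {x′} {y′} x≗x′ y≗y′ P i =
  trans (cong ones (sym (nbhd-cong x≗x′ y≗y′))) (proj₁ (P i)) ,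
  trans (cong ones (sym (nbhd-cong y≗y′ x≗x′))) (proj₂ (P i))
  where
    nbhd-cong : ∀ {u v u′ v′} → u ≗ u′ → v ≗ v′ → ladderNbhd u v i ≡ ladderNbhd u′ v′ i
    nbhd-cong u≗u′ v≗v′ =
      cong₂ _∷_ (u≗u′ _) (cong₂ _∷_ (u≗u′ _) (cong₂ _∷_ (u≗u′ _) (cong₂ _∷_ (v≗v′ _) refl)))

pulse : ℕ → Bool
pulse 0 = true
pulse 1 = false
pulse 2 = false
pulse 3 = false
pulse (suc (suc (suc (suc i)))) = pulse i

pulse-perfect : LadderPerfect pulse (λ i → pulse (2 + i))
pulse-perfect 0 = refl , refl
pulse-perfect 1 = refl , refl
pulse-perfect 2 = refl , refl
pulse-perfect 3 = refl , refl
pulse-perfect (suc (suc (suc (suc i)))) = pulse-perfect i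

-- x-row vertices in the columns ≡ r, y-row vertices in the columns ≡ r + 2 (mod 4).
ladderCode : Fin 4 → ℕ → Bool
ladderCode r i = pulse (i + (4 ∸ toℕ r))

ladderCode-perfect : ∀ r → LadderPerfect (ladderCode r) (λ i → ladderCode r (2 + i))
ladderCode-perfect r i = pulse-perfect (i + (4 ∸ toℕ r))

ladderCode-diagonal : ∀ r → ladderCode r (toℕ r) ≡ true
ladderCode-diagonal r = cong pulse (m+[n∸m]≡n (<⇒≤ (toℕ<n r)))

ladderCode-separates : ∀ r r′ → ladderCode r′ (toℕ r) ≡ true → r′ ≡ r
ladderCode-separates = from-yes (all? λ r → all? λ r′ → (ladderCode r′ (toℕ r) ≟ᵇ true) →-dec (r′ ≟ᶠ r))

ladder-column≤1 : ∀ {x y} → LadderPerfect x y → ∀ i → ⟦ x (suc i) ⟧ + ⟦ y (suc i) ⟧ ≤ 1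
ladder-column≤1 {x} {y} P i = begin
  ⟦ x₁ ⟧ + ⟦ y₁ ⟧                      ≤⟨ m≤m+n _ (⟦ x₀ ⟧ + ⟦ x₂ ⟧) ⟩
  ⟦ x₁ ⟧ + ⟦ y₁ ⟧ + (⟦ x₀ ⟧ + ⟦ x₂ ⟧)  ≡⟨ regroup ⟦ x₀ ⟧ ⟦ x₁ ⟧ ⟦ x₂ ⟧ ⟦ y₁ ⟧ ⟩
  ones (ladderNbhd x y i)              ≡⟨ proj₁ (P i) ⟩
  1                                    ∎
  where
    open ≤-Reasoning
    x₀ x₁ x₂ y₁ : Bool
    x₀ = x i
    x₁ = x (suc i)
    x₂ = x (suc (suc i))
    y₁ = y (suc i)
    regroup : ∀ x₀ x₁ x₂ y₁ → x₁ + y₁ + (x₀ + x₂) ≡ x₀ + (x₁ + (x₂ + (y₁ + 0)))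
    regroup = solve-∀

adjacent-columns≡1 : ∀ {c₁ c₂ c₃} → c₁ ≤ 1 → c₂ ≤ 1 → c₃ ≤ 1 → (c₁ + c₂) + (c₂ + c₃) ≡ 2 → c₁ + c₂ ≡ 1
adjacent-columns≡1 z≤n       z≤n       z≤n       ()
adjacent-columns≡1 z≤n       z≤n       (s≤s z≤n) ()
adjacent-columns≡1 z≤n       (s≤s z≤n) _         _ = refl
adjacent-columns≡1 (s≤s z≤n) z≤n       _         _ = refl
adjacent-columns≡1 (s≤s z≤n) (s≤s z≤n) _         ()

-- Columns 1, 2, 3 hold at most one vertex each, and the closed neighbourhoods of the two vertices of
-- column 2 together count c₁ + 2 c₂ + c₃ = 2 vertices.
ladder-columns-1-2 : ∀ {x y} → LadderPerfect x y → (⟦ x 1 ⟧ + ⟦ y 1 ⟧) + (⟦ x 2 ⟧ + ⟦ y 2 ⟧) ≡ 1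
ladder-columns-1-2 {x} {y} P =
  adjacent-columns≡1 (column≤1 0) (column≤1 1) (column≤1 2)
    (trans (regroup ⟦ x 1 ⟧ ⟦ y 1 ⟧ ⟦ x 2 ⟧ ⟦ y 2 ⟧ ⟦ x 3 ⟧ ⟦ y 3 ⟧)
           (cong₂ _+_ (proj₁ (P 1)) (proj₂ (P 1))))
  where
    column≤1 : ∀ i → ⟦ x (suc i) ⟧ + ⟦ y (suc i) ⟧ ≤ 1
    column≤1 = ladder-column≤1 {x} {y} P
    regroup : ∀ x₁ y₁ x₂ y₂ x₃ y₃ →
              (x₁ + y₁ + (x₂ + y₂)) + ((x₂ + y₂) + (x₃ + y₃)) ≡
              (x₁ + (x₂ + (x₃ + (y₂ + 0)))) + (y₁ + (y₂ + (y₃ + (x₂ + 0))))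
    regroup = solve-∀

columns-1-2⇒ladderCode : ∀ x₁ y₁ x₂ y₂ → (⟦ x₁ ⟧ + ⟦ y₁ ⟧) + (⟦ x₂ ⟧ + ⟦ y₂ ⟧) ≡ 1 →
                         ∃[ r ] (x₁ ≡ ladderCode r 1 × y₁ ≡ ladderCode r 3)
                              × (x₂ ≡ ladderCode r 2 × y₂ ≡ ladderCode r 4)
columns-1-2⇒ladderCode true  false false false _ = suc zero , (refl , refl) , (refl , refl)
columns-1-2⇒ladderCode false true  false false _ = suc (suc (suc zero)) , (refl , refl) , (refl , refl)
columns-1-2⇒ladderCode false false true  false _ = suc (suc zero) , (refl , refl) , (refl , refl)
columns-1-2⇒ladderCode false false false true  _ = zero , (refl , refl) , (refl , refl)
columns-1-2⇒ladderCode true  true  _     _     ()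
columns-1-2⇒ladderCode true  false true  _     ()
columns-1-2⇒ladderCode true  false false true  ()
columns-1-2⇒ladderCode false true  true  _     ()
columns-1-2⇒ladderCode false true  false true  ()
columns-1-2⇒ladderCode false false true  true  ()
columns-1-2⇒ladderCode false false false false ()

third-determined : ∀ {u₀ u₁ u₂ u₃ u₀′ u₁′ u₂′ u₃′} → u₀ ≡ u₀′ → u₁ ≡ u₁′ → u₃ ≡ u₃′ →
                   ones (u₀ ∷ u₁ ∷ u₂ ∷ u₃ ∷ []) ≡ 1 → ones (u₀′ ∷ u₁′ ∷ u₂′ ∷ u₃′ ∷ []) ≡ 1 → u₂ ≡ u₂′
third-determined {u₀} {u₁} {u₂} {u₃} refl refl refl e e′ =
  ones-cancel (u₀ ∷ u₁ ∷ []) {u₃ ∷ []} (trans e (sym e′))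

first-determined : ∀ {u₀ u₁ u₂ u₃ u₀′ u₁′ u₂′ u₃′} → u₁ ≡ u₁′ → u₂ ≡ u₂′ → u₃ ≡ u₃′ →
                   ones (u₀ ∷ u₁ ∷ u₂ ∷ u₃ ∷ []) ≡ 1 → ones (u₀′ ∷ u₁′ ∷ u₂′ ∷ u₃′ ∷ []) ≡ 1 → u₀ ≡ u₀′
first-determined {u₀} {u₁} {u₂} {u₃} refl refl refl e e′ =
  ones-cancel [] {u₁ ∷ u₂ ∷ u₃ ∷ []} (trans e (sym e′))

module LadderDeterminacy {x y x′ y′ : ℕ → Bool} (P : LadderPerfect x y) (P′ : LadderPerfect x′ y′) where

  SameColumn : ℕ → Set
  SameColumn i = x i ≡ x′ i × y i ≡ y′ i

  sameColumn-next : ∀ {i} → SameColumn i → SameColumn (suc i) → SameColumn (suc (suc i))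
  sameColumn-next {i} (xᵢ , yᵢ) (xᵢ₊₁ , yᵢ₊₁) =
    third-determined xᵢ xᵢ₊₁ yᵢ₊₁ (proj₁ (P i)) (proj₁ (P′ i)) ,
    third-determined yᵢ yᵢ₊₁ xᵢ₊₁ (proj₂ (P i)) (proj₂ (P′ i))

  sameColumn-previous : ∀ {i} → SameColumn (suc i) → SameColumn (suc (suc i)) → SameColumn i
  sameColumn-previous {i} (xᵢ₊₁ , yᵢ₊₁) (xᵢ₊₂ , yᵢ₊₂) =
    first-determined xᵢ₊₁ xᵢ₊₂ yᵢ₊₁ (proj₁ (P i)) (proj₁ (P′ i)) ,
    first-determined yᵢ₊₁ yᵢ₊₂ xᵢ₊₁ (proj₂ (P i)) (proj₂ (P′ i))

  sameColumn-all : SameColumn 1 → SameColumn 2 → ∀ i → SameColumn i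
  sameColumn-all same₁ same₂ i = proj₁ (consecutive i)
    where
      consecutive : ∀ i → SameColumn i × SameColumn (suc i)
      consecutive zero    = sameColumn-previous same₁ same₂ , same₁
      consecutive (suc i) = let sameᵢ , sameᵢ₊₁ = consecutive i in sameᵢ₊₁ , sameColumn-next sameᵢ sameᵢ₊₁

ladderPerfect-classification : ∀ {x y} → LadderPerfect x y →
                               ∃[ r ] (∀ i → x i ≡ ladderCode r i × y i ≡ ladderCode r (2 + i))
ladderPerfect-classification {x} {y} P =
  let r , same₁ , same₂ = columns-1-2⇒ladderCode (x 1) (y 1) (x 2) (y 2) (ladder-columns-1-2 {x} {y} P)
  in  r , LadderDeterminacy.sameColumn-all {x} {y} P (ladderCode-perfect r) same₁ same₂

module Prism (n : ℕ) .{{_ : NonZero n}} where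

  sucₙ : Fin n → Fin n
  sucₙ j = suc (toℕ j) mod n

  predₙ : Fin n → Fin n
  predₙ j = (pred n + toℕ j) mod n

  mod-cong : ∀ {i k} → i % n ≡ k % n → i mod n ≡ k mod n
  mod-cong e = toℕ-injective (trans (toℕ-fromℕ< _) (trans e (sym (toℕ-fromℕ< _))))

  toℕ-mod : ∀ j → toℕ j mod n ≡ j
  toℕ-mod j = toℕ-injective (trans (toℕ-fromℕ< _) (m<n⇒m%n≡m (toℕ<n j)))

  sucₙ-mod : ∀ i → sucₙ (i mod n) ≡ suc i mod n
  sucₙ-mod i = mod-cong (trans (cong (λ k → suc k % n) (toℕ-fromℕ< _)) ([m+n%d]%d≡[m+n]%d 1 i n))

  suc-pred-mod : ∀ j → suc (pred n + toℕ j) mod n ≡ j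
  suc-pred-mod j = trans (mod-cong e) (toℕ-mod j)
    where
      e : suc (pred n + toℕ j) % n ≡ toℕ j % n
      e = trans (cong (λ m → (m + toℕ j) % n) (suc-pred n)) (%-remove-+ˡ (toℕ j) ∣-refl)

  sucₙ-predₙ : ∀ j → sucₙ (predₙ j) ≡ j
  sucₙ-predₙ j = trans (sucₙ-mod _) (suc-pred-mod j)

  predₙ-sucₙ : ∀ j → predₙ (sucₙ j) ≡ j
  predₙ-sucₙ j = trans (mod-cong e) (suc-pred-mod j)
    where
      open ≡-Reasoning
      e : (pred n + toℕ (sucₙ j)) % n ≡ suc (pred n + toℕ j) % n
      e = begin
        (pred n + toℕ (sucₙ j)) % n      ≡⟨ cong (λ k → (pred n + k) % n) (toℕ-fromℕ< _) ⟩
        (pred n + suc (toℕ j) % n) % n   ≡⟨ [m+n%d]%d≡[m+n]%d (pred n) (suc (toℕ j)) n ⟩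
        (pred n + suc (toℕ j)) % n       ≡⟨ cong (_% n) (+-suc (pred n) (toℕ j)) ⟩
        suc (pred n + toℕ j) % n         ∎

  rotation : Permutation n n
  rotation = permutation sucₙ predₙ sucₙ-predₙ predₙ-sucₙ

  ∑-sucₙ : ∀ (f : Fin n → ℕ) → ∑[ j < n ] f (sucₙ j) ≡ ∑[ j < n ] f j
  ∑-sucₙ f = sym (∑-permute f rotation)

  ∑-predₙ : ∀ (f : Fin n → ℕ) → ∑[ j < n ] f (predₙ j) ≡ ∑[ j < n ] f j
  ∑-predₙ f = sym (∑-permute f (flip rotation))

  cycAdj-sucₙ : ∀ j → cycAdj n j (sucₙ j)
  cycAdj-sucₙ j = inj₁ (toℕ-fromℕ< _)

  cycAdj-predₙ : ∀ j → cycAdj n j (predₙ j)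
  cycAdj-predₙ j = inj₂ (trans (cong toℕ (sym (sucₙ-predₙ j))) (toℕ-fromℕ< _))

  cycAdj⇒sucₙ⊎predₙ : ∀ {j k} → cycAdj n j k → k ≡ sucₙ j ⊎ k ≡ predₙ j
  cycAdj⇒sucₙ⊎predₙ         (inj₁ e) = inj₁ (toℕ-injective (trans e (sym (toℕ-fromℕ< _))))
  cycAdj⇒sucₙ⊎predₙ {j} {k} (inj₂ e) =
    inj₂ (trans (sym (predₙ-sucₙ k)) (cong predₙ (toℕ-injective (trans (toℕ-fromℕ< _) (sym e)))))

  row : VSet n → Side → Vec Bool n
  row (T₀ , B₀) t = T₀
  row (T₀ , B₀) b = B₀

  ∈ₛ⇒row : ∀ S s j → (s , j) ∈ₛ S → T (lookup (row S s) j)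
  ∈ₛ⇒row (T₀ , B₀) t j m = m
  ∈ₛ⇒row (T₀ , B₀) b j m = m

  row⇒∈ₛ : ∀ S s j → T (lookup (row S s) j) → (s , j) ∈ₛ S
  row⇒∈ₛ (T₀ , B₀) t j m = m
  row⇒∈ₛ (T₀ , B₀) b j m = m

  closedNbhd : VSet n → Vertex n → List Bool
  closedNbhd S (s , j) =
    lookup (row S s) (predₙ j) ∷ lookup (row S s) j ∷ lookup (row S s) (sucₙ j) ∷
    lookup (row S (other s)) j ∷ []

  domCount : VSet n → Vertex n → ℕ
  domCount S v = ones (closedNbhd S v)

  Dominated : VSet n → Vertex n → Set
  Dominated S v = v ∈ₛ S ⊎ ∃[ u ] (u ∈ₛ S × Adj n v u)

  dominated⇒closedNbhd : ∀ S v → Dominated S v → Any T (closedNbhd S v)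
  dominated⇒closedNbhd S (s , j) (inj₁ m) = there (here (∈ₛ⇒row S s j m))
  dominated⇒closedNbhd S (s , j) (inj₂ ((s , k) , m , inj₁ (refl , adj))) with cycAdj⇒sucₙ⊎predₙ adj
  ... | inj₁ refl = there (there (here (∈ₛ⇒row S s k m)))
  ... | inj₂ refl = here (∈ₛ⇒row S s k m)
  dominated⇒closedNbhd S (s , j) (inj₂ ((_ , j) , m , inj₂ (refl , refl))) =
    there (there (there (here (∈ₛ⇒row S (other s) j m))))

  closedNbhd⇒dominated : ∀ S v → Any T (closedNbhd S v) → Dominated S v
  closedNbhd⇒dominated S (s , j) (here m) =
    inj₂ ((s , predₙ j) , row⇒∈ₛ S s (predₙ j) m , inj₁ (refl , cycAdj-predₙ j))
  closedNbhd⇒dominated S (s , j) (there (here m)) =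
    inj₁ (row⇒∈ₛ S s j m)
  closedNbhd⇒dominated S (s , j) (there (there (here m))) =
    inj₂ ((s , sucₙ j) , row⇒∈ₛ S s (sucₙ j) m , inj₁ (refl , cycAdj-sucₙ j))
  closedNbhd⇒dominated S (s , j) (there (there (there (here m)))) =
    inj₂ ((other s , j) , row⇒∈ₛ S (other s) j m , inj₂ (refl , refl))

  dominating⇒domCount≥1 : ∀ {S} → Dominating n S → ∀ v → 1 ≤ domCount S v
  dominating⇒domCount≥1 {S} d v = Any⇒ones-positive (dominated⇒closedNbhd S v (d v))

  columnCount : VSet n → Fin n → ℕ
  columnCount S j = domCount S (t , j) + domCount S (b , j)

  weight : Vec Bool n → ℕ
  weight V = ∑[ j < n ] ⟦ lookup V j ⟧

  ∑-domCount : ∀ S s → ∑[ j < n ] domCount S (s , j) ≡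
                        weight (row S s) + weight (row S s) + weight (row S s) + weight (row S (other s))
  ∑-domCount S s =
    trans (∑-ones (V ∘ predₙ) V (V ∘ sucₙ) (lookup (row S (other s))))
          (cong₂ (λ p q → p + weight (row S s) + q + weight (row S (other s)))
                 (∑-predₙ (⟦_⟧ ∘ V)) (∑-sucₙ (⟦_⟧ ∘ V)))
    where
      V : Fin n → Bool
      V = lookup (row S s)

  ∑-columnCount : ∀ S → ∑[ j < n ] columnCount S j ≡ 4 * size S
  ∑-columnCount S@(T₀ , B₀) = begin
    ∑[ j < n ] columnCount S j
      ≡⟨ ∑-distrib-+ (λ j → domCount S (t , j)) (λ j → domCount S (b , j)) ⟩
    ∑[ j < n ] domCount S (t , j) + ∑[ j < n ] domCount S (b , j)
      ≡⟨ cong₂ _+_ (∑-domCount S t) (∑-domCount S b) ⟩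
    (weight T₀ + weight T₀ + weight T₀ + weight B₀) + (weight B₀ + weight B₀ + weight B₀ + weight T₀)
      ≡⟨ regroup (weight T₀) (weight B₀) ⟩
    4 * (weight T₀ + weight B₀)
      ≡⟨ cong (4 *_) (cong₂ _+_ (count-T?-as-∑ T₀) (count-T?-as-∑ B₀)) ⟨
    4 * size S ∎
    where
      open ≡-Reasoning
      regroup : ∀ x y → (x + x + x + y) + (y + y + y + x) ≡ 4 * (x + y)
      regroup = solve-∀

  Perfect : VSet n → Set
  Perfect S = ∀ v → domCount S v ≡ 1

  perfect⇒dominating : ∀ {P} → Perfect P → Dominating n P
  perfect⇒dominating {P} perfect v =
    closedNbhd⇒dominated P v (ones-positive⇒Any _ (≤-reflexive (sym (perfect v))))

  perfect-columnCount≤ : ∀ {P S} → Perfect P → Dominating n S → ∀ j → columnCount P j ≤ columnCount S j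
  perfect-columnCount≤ {P} {S} perfect d j =
    subst (_≤ columnCount S j) (cong₂ _+_ (sym (perfect (t , j))) (sym (perfect (b , j))))
          (+-mono-≤ (dominating⇒domCount≥1 d (t , j)) (dominating⇒domCount≥1 d (b , j)))

  perfect-minimum : ∀ {P S} → Perfect P → Dominating n S → size P ≤ size S
  perfect-minimum {P} {S} perfect d = *-cancelˡ-≤ 4 (begin
    4 * size P                    ≡⟨ ∑-columnCount P ⟨
    ∑[ j < n ] columnCount P j    ≤⟨ ∑-mono-≤ (perfect-columnCount≤ perfect d) ⟩
    ∑[ j < n ] columnCount S j    ≡⟨ ∑-columnCount S ⟩
    4 * size S                    ∎)
    where open ≤-Reasoning

  perfect⇒minDominating : ∀ {P} → Perfect P → MinDominating n P
  perfect⇒minDominating perfect = perfect⇒dominating perfect , λ _ d → perfect-minimum perfect d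

  minDominating⇒perfect : ∀ {P S} → Perfect P → MinDominating n S → Perfect S
  minDominating⇒perfect {P} {S} perfect (d , minimal) (s , j) = on s
    where
      ∑S≤∑P : ∑[ j < n ] columnCount S j ≤ ∑[ j < n ] columnCount P j
      ∑S≤∑P = begin
        ∑[ j < n ] columnCount S j  ≡⟨ ∑-columnCount S ⟩
        4 * size S                  ≤⟨ *-monoʳ-≤ 4 (minimal P (perfect⇒dominating perfect)) ⟩
        4 * size P                  ≡⟨ ∑-columnCount P ⟨
        ∑[ j < n ] columnCount P j  ∎
        where open ≤-Reasoning
      column : 1 ≡ domCount S (t , j) × 1 ≡ domCount S (b , j)
      column = +-mono-≤-tight (dominating⇒domCount≥1 d (t , j)) (dominating⇒domCount≥1 d (b , j))
        (≤-reflexive (trans (sym (∑-mono-≤-tight (perfect-columnCount≤ perfect d) ∑S≤∑P j))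
                            (cong₂ _+_ (perfect (t , j)) (perfect (b , j)))))
      on : ∀ s → domCount S (s , j) ≡ 1
      on t = sym (proj₁ column)
      on b = sym (proj₂ column)

  ladderRow : VSet n → Side → ℕ → Bool
  ladderRow S s i = lookup (row S s) (i mod n)

  closedNbhd-ladder : ∀ S s i →
                      closedNbhd S (s , suc i mod n) ≡ ladderNbhd (ladderRow S s) (ladderRow S (other s)) i
  closedNbhd-ladder S s i =
    cong₂ _∷_ (cong V predₙ-suc) (cong (V (suc i mod n) ∷_) (cong₂ _∷_ (cong V (sucₙ-mod (suc i))) refl))
    where
      V : Fin n → Bool
      V = lookup (row S s)
      predₙ-suc : predₙ (suc i mod n) ≡ i mod n
      predₙ-suc = trans (cong predₙ (sym (sucₙ-mod i))) (predₙ-sucₙ (i mod n))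

  perfect⇒ladderPerfect : ∀ {S} → Perfect S → LadderPerfect (ladderRow S t) (ladderRow S b)
  perfect⇒ladderPerfect {S} perfect i = on t , on b
    where
      on : ∀ s → ones (ladderNbhd (ladderRow S s) (ladderRow S (other s)) i) ≡ 1
      on s = trans (cong ones (sym (closedNbhd-ladder S s i))) (perfect (s , suc i mod n))

  ladderPerfect⇒perfect : ∀ {S} → LadderPerfect (ladderRow S t) (ladderRow S b) → Perfect S
  ladderPerfect⇒perfect {S} P (s , j) = begin
    domCount S (s , j)                 ≡⟨ cong (λ k → domCount S (s , k)) (suc-pred-mod j) ⟨
    domCount S (s , suc i mod n)       ≡⟨ cong ones (closedNbhd-ladder S s i) ⟩
    ones (ladderNbhd (ladderRow S s) (ladderRow S (other s)) i) ≡⟨ on s ⟩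
    1                                  ∎
    where
      open ≡-Reasoning
      i : ℕ
      i = pred n + toℕ j
      on : ∀ s → ones (ladderNbhd (ladderRow S s) (ladderRow S (other s)) i) ≡ 1
      on t = proj₁ (P i)
      on b = proj₂ (P i)

  fromLadder : (ℕ → Bool) → Vec Bool n
  fromLadder x = tabulate (λ j → x (toℕ j))

  lookup-fromLadder : ∀ x j → lookup (fromLadder x) j ≡ x (toℕ j)
  lookup-fromLadder x j = lookup∘tabulate (λ j → x (toℕ j)) j

  fromLadder-unique : ∀ {x} V → (∀ i → lookup V (i mod n) ≡ x i) → fromLadder x ≡ V
  fromLadder-unique V h =
    trans (tabulate-cong (λ j → trans (sym (h (toℕ j))) (cong (lookup V) (toℕ-mod j)))) (tabulate∘lookup V)

  fromLadder-periodic : ∀ {x} → Periodic n x → ∀ i → lookup (fromLadder x) (i mod n) ≡ x i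
  fromLadder-periodic {x} per i =
    trans (lookup-fromLadder x (i mod n)) (trans (cong x (toℕ-fromℕ< _)) (periodic-% per i))

  candidate : Fin 4 → VSet n
  candidate r = fromLadder (ladderCode r) , fromLadder (λ i → ladderCode r (2 + i))

  perfect⇒candidate : ∀ {S} → Perfect S → ∃[ r ] candidate r ≡ S
  perfect⇒candidate {T₀ , B₀} perfect =
    let r , same = ladderPerfect-classification (perfect⇒ladderPerfect perfect)
    in  r , cong₂ _,_ (fromLadder-unique T₀ (proj₁ ∘ same)) (fromLadder-unique B₀ (proj₂ ∘ same))

  candidate-perfect : 4 ∣ n → ∀ r → Perfect (candidate r)
  candidate-perfect 4∣n r = ladderPerfect⇒perfect (ladderPerfect-cong top bottom (ladderCode-perfect r))
    where
      unroll : ∀ {x} → Periodic 4 x → ∀ i → x i ≡ lookup (fromLadder x) (i mod n)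
      unroll per i = sym (fromLadder-periodic (periodic-∣ 4∣n per) i)
      top : ladderCode r ≗ ladderRow (candidate r) t
      top = unroll (λ _ → refl)
      bottom : (λ i → ladderCode r (2 + i)) ≗ ladderRow (candidate r) b
      bottom = unroll (λ _ → refl)

  candidate-injective : 4 ≤ n → Injective _≡_ _≡_ candidate
  candidate-injective 4≤n {r} {r′} e = sym (ladderCode-separates r r′ (begin
    ladderCode r′ (toℕ r)                 ≡⟨ at-r (ladderCode r′) ⟨
    lookup (fromLadder (ladderCode r′)) j ≡⟨ cong (λ S → lookup (proj₁ S) j) e ⟨
    lookup (fromLadder (ladderCode r)) j  ≡⟨ at-r (ladderCode r) ⟩
    ladderCode r (toℕ r)                  ≡⟨ ladderCode-diagonal r ⟩
    true                                  ∎))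
    where
      open ≡-Reasoning
      j : Fin n
      j = fromℕ< (≤-trans (toℕ<n r) 4≤n)
      at-r : ∀ x → lookup (fromLadder x) j ≡ x (toℕ r)
      at-r x = trans (lookup-fromLadder x j) (cong x (toℕ-fromℕ< _))

  _≟ₛ_ : DecidableEquality (VSet n)
  _≟ₛ_ = ×-≡-dec (Vec-≡-dec _≟ᵇ_) (Vec-≡-dec _≟ᵇ_)

↔-image : ∀ {a ℓ p} {A : Set a} {B : Set ℓ} {P : B → Set p} (f : A → B) → Injective _≡_ _≡_ f →
          (∀ {y} → Irrelevant (P y)) → (∀ x → P (f x)) → (∀ {y} → P y → ∃[ x ] f x ≡ y) → A ↔ Σ B P
↔-image {A = A} {B} {P} f f-injective P-irrelevant P-image image-P = mk↔ₛ′ to from to∘from from∘to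
  where
    to : A → Σ B P
    to x = f x , P-image x
    from : Σ B P → A
    from (y , p) = proj₁ (image-P p)
    to∘from : ∀ y → to (from y) ≡ y
    to∘from (y , p) = Σ-≡,≡→≡ (proj₂ (image-P p) , P-irrelevant _ _)
    from∘to : ∀ x → from (to x) ≡ x
    from∘to x = f-injective (proj₂ (image-P (P-image x)))

corollary3p6 : (n : ℕ) → .{{_ : NonZero n}} → 4 ≤ n → n % 4 ≡ 0 → Fin 4 ↔ Σ (VSet n) (IsMinDom n)
corollary3p6 n 4≤n n%4≡0 =
  ↔-image candidate (candidate-injective 4≤n) (λ _ _ → refl)
    (λ r → isMinDom (perfect⇒minDominating (candidate-perfect 4∣n r)))
    (λ { {S} (isMinDom minimum) → recompute (any? (λ r → candidate r ≟ₛ S))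
           (perfect⇒candidate (minDominating⇒perfect (candidate-perfect 4∣n zero) minimum)) })
  where
    open Prism n
    4∣n : 4 ∣ n
    4∣n = m%n≡0⇒n∣m n 4 n%4≡0
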